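{- For all integers $k\ge2$ and $n\ge0$, there is a bijection between $\mathcal{T}^k_n$ and $\overline{\mathcal{Q}}^k_n$.
   Context: $\overline{\mathcal{Q}}^k_n$ is the set of permutations of the multiset $\{1^k,\dots,n^k\}$ ($k$ copies of each $i\in[n]$) avoiding the patterns $1212$ and $2121$ (no indices $i<j<l<m$ with $\pi_i=\pi_l\neq\pi_j=\pi_m$). For $k\ge2$, $\mathcal{T}^k_n$ (compartmented trees) is the set of plane rooted trees with $n$ edges, labeled bijectively by $[n]$, in which every non-root vertex additionally carries $k-2$ unlabeled half-edges (walls) placed among its children, separating its ordered list of children into $k-1$ consecutive, possibly empty, compartments; two such trees are equal when they agree as plane trees, in edge labels, and in the placement of the walls. -}

module Defs where

open import Data.Nat using (ℕ; _*_; _<_; _∸_)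
open import Data.Fin using (Fin; toℕ)
open import Data.List using (List; []; _∷_; _++_; length; lookup; allFin; concatMap; replicate)
open import Data.Vec using (Vec; []; _∷_)
open import Data.Product using (Σ; ∃; _×_; proj₁)
open import Relation.Binary.PropositionalEquality using (_≡_; _≢_; refl; sym; trans)
open import Relation.Binary.Bundles using (Setoid)
open import Relation.Nullary using (¬_)
open import Data.List.Relation.Binary.Permutation.Propositional using (_↭_)

multiset : (k n : ℕ) → List (Fin n)
multiset k n = concatMap (replicate k) (allFin n)

Contains1212or2121 : {A : Set} → List A → Set
Contains1212or2121 w =
  ∃ λ (i : Fin (length w)) → ∃ λ (j : Fin (length w)) →
  ∃ λ (l : Fin (length w)) → ∃ λ (m : Fin (length w)) →
    (toℕ i < toℕ j) × (toℕ j < toℕ l) × (toℕ l < toℕ m) ×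
    (lookup w i ≡ lookup w l) × (lookup w j ≡ lookup w m) ×
    (lookup w i ≢ lookup w j)

Q̄ : (k n : ℕ) → Set
Q̄ k n = Σ (List (Fin n)) λ w → (w ↭ multiset k n) × ¬ Contains1212or2121 w

-- A non-root vertex together with the edge coming into it from its parent:
-- the edge label (in Fin n) and the vertex's ordered children split into
-- m = k - 1 consecutive (possibly empty) compartments (i.e. k - 2 walls).
data Sub (m n : ℕ) : Set where
  node : Fin n → Vec (List (Sub m n)) m → Sub m n

-- A plane rooted tree: the ordered list of subtrees hanging from the root
-- (the root carries no walls).
PlaneTree : (m n : ℕ) → Set
PlaneTree m n = List (Sub m n)

mutual
  labelsSub : ∀ {m n} → Sub m n → List (Fin n)
  labelsSub (node a cs) = a ∷ labelsComps cs

  labelsComps : ∀ {m n k} → Vec (List (Sub m n)) k → List (Fin n)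
  labelsComps [] = []
  labelsComps (c ∷ cs) = labelsList c ++ labelsComps cs

  labelsList : ∀ {m n} → List (Sub m n) → List (Fin n)
  labelsList [] = []
  labelsList (t ∷ ts) = labelsSub t ++ labelsList ts

T : (k n : ℕ) → Set
T k n = Σ (PlaneTree (k ∸ 1) n) λ t → labelsList t ↭ allFin n

-- Sets as setoids: two elements are equal iff their underlying objects
-- (tree, resp. word) are equal; the membership proofs are irrelevant.

subSetoid : {A : Set} (P : A → Set) → Setoid _ _
subSetoid {A} P = record
  { Carrier = Σ A P
  ; _≈_ = λ x y → proj₁ x ≡ proj₁ y
  ; isEquivalence = record { refl = refl ; sym = sym ; trans = trans }
  }

T-setoid : (k n : ℕ) → Setoid _ _
T-setoid k n = subSetoid {PlaneTree (k ∸ 1) n} (λ t → labelsList t ↭ allFin n)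

Q̄-setoid : (k n : ℕ) → Setoid _ _
Q̄-setoid k n = subSetoid {List (Fin n)} (λ w → (w ↭ multiset k n) × ¬ Contains1212or2121 w)

-- A vertex whose incoming edge is labelled a and whose compartments are c₁, …, c_{k-1} is
-- encoded as the word a w(c₁) a w(c₂) a … a w(c_{k-1}) a, and a list of trees as the
-- concatenation of the words of its trees; every label then occurs exactly k times. When the
-- labels are distinct, the letters of different subtrees are disjoint and every compartment
-- lies between two copies of its parent's label, so no abab with a ≠ b can be formed.
-- Conversely, in an abab-free word whose letters occur 0 or k times each, the first letter a
-- and its next k - 1 occurrences cut out the compartments of the first tree: by avoidance,
-- a letter between two consecutive a's occurs nowhere else. Decoding along these cuts inverts
-- the encoding, and distinctness of the labels makes the cuts unique.
module Submission where

open import Data.Nat using (ℕ; zero; suc; _+_; _*_; _≤_; _<_; z≤n; s≤s)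
open import Data.Nat.Properties
  using ( +-assoc; +-comm; +-identityʳ; +-cancelˡ-≡; +-monoʳ-≤
        ; *-zeroʳ; *-identityʳ; *-distribˡ-+; *-cancelˡ-≡; suc-injective
        ; ≤-refl; ≤-reflexive; ≤-trans; m≤n+m; n≤1+n; n<1⇒n≡0; ≰⇒>; <⇒≢ )
open import Data.Nat.Tactic.RingSolver using (solve-∀)
open import Data.Fin using (Fin; toℕ) renaming (zero to fzero; suc to fsuc)
open import Data.Fin.Properties using (_≟_) renaming (suc-injective to fsuc-injective)
open import Data.List using (List; []; _∷_; _++_; length; lookup; replicate; concatMap; tabulate; allFin)
open import Data.List.Properties using (∷-injective; ++-assoc)
open import Data.List.Relation.Binary.Permutation.Propositional
  using (_↭_; prep; swap; ↭-sym) renaming (refl to ↭-refl; trans to ↭-trans)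
open import Data.List.Relation.Binary.Permutation.Propositional.Properties using (shift)
open import Data.List.Relation.Binary.Sublist.Propositional.Properties
  using (++⁺; ++⁺ˡ; ++⁺ʳ; length-mono-≤)
open import Data.Vec using (Vec; []; _∷_)
open import Data.Product using (∃; ∃₂; _×_; _,_; proj₁)
open import Data.Sum using (_⊎_; inj₁; inj₂)
open import Data.Unit using (⊤; tt)
open import Data.Empty using (⊥)
open import Function using (_∘_)
open import Function.Bundles using (Bijection)
open import Relation.Binary.Definitions using (DecidableEquality)
open import Relation.Binary.PropositionalEquality
open import Relation.Nullary using (¬_; yes; no; contradiction)

open import Defs

module Words {A : Set} (_≟_ : DecidableEquality A) where

  open import Data.List.Relation.Binary.Sublist.Propositional {A = A}
    using (_⊆_; []; _∷_; _∷ʳ_; ⊆-refl; ⊆-trans; minimum)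

  -- Occurrence counts

  δ : A → A → ℕ
  δ x z with x ≟ z
  ... | yes _ = 1
  ... | no  _ = 0

  δ-refl : ∀ x → δ x x ≡ 1
  δ-refl x with x ≟ x
  ... | yes _  = refl
  ... | no x≢x = contradiction refl x≢x

  δ-≢ : ∀ {x z} → x ≢ z → δ x z ≡ 0
  δ-≢ {x} {z} x≢z with x ≟ z
  ... | yes x≡z = contradiction x≡z x≢z
  ... | no  _   = refl

  δ-pos⇒≡ : ∀ {x z} → 0 < δ x z → x ≡ z
  δ-pos⇒≡ {x} {z} p with x ≟ z
  ... | yes x≡z = x≡z

  count : A → List A → ℕ
  count z []       = 0
  count z (x ∷ xs) = δ x z + count z xs

  Occurs : A → List A → Set
  Occurs z u = 0 < count z u

  Disjoint : List A → List A → Set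
  Disjoint u v = ∀ z → Occurs z u → Occurs z v → ⊥

  Distinct : List A → Set
  Distinct xs = ∀ z → ¬ (z ∷ z ∷ [] ⊆ xs)

  count-++ : ∀ z xs ys → count z (xs ++ ys) ≡ count z xs + count z ys
  count-++ z []       ys = refl
  count-++ z (x ∷ xs) ys = trans (cong (δ x z +_) (count-++ z xs ys)) (sym (+-assoc (δ x z) _ _))

  count-∷-≡ : ∀ a xs → count a (a ∷ xs) ≡ suc (count a xs)
  count-∷-≡ a xs = cong (_+ count a xs) (δ-refl a)

  count-∷-≢ : ∀ {a z} xs → a ≢ z → count z (a ∷ xs) ≡ count z xs
  count-∷-≢ xs a≢z = cong (_+ count _ xs) (δ-≢ a≢z)

  ¬Occurs⇒count≡0 : ∀ z xs → ¬ Occurs z xs → count z xs ≡ 0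
  ¬Occurs⇒count≡0 z xs z∉xs = n<1⇒n≡0 (≰⇒> z∉xs)

  count-++-¬Occursˡ : ∀ z xs ys → ¬ Occurs z xs → count z (xs ++ ys) ≡ count z ys
  count-++-¬Occursˡ z xs ys z∉xs =
    trans (count-++ z xs ys) (cong (_+ count z ys) (¬Occurs⇒count≡0 z xs z∉xs))

  count-++-¬Occursʳ : ∀ z xs ys → ¬ Occurs z ys → count z (xs ++ ys) ≡ count z xs
  count-++-¬Occursʳ z xs ys z∉ys =
    trans (count-++ z xs ys) (trans (cong (count z xs +_) (¬Occurs⇒count≡0 z ys z∉ys)) (+-identityʳ _))

  count-replicate : ∀ k x z → count z (replicate k x) ≡ k * δ x z
  count-replicate zero    x z = refl
  count-replicate (suc k) x z = cong (δ x z +_) (count-replicate k x z)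

  count-concatMap-replicate : ∀ k xs z → count z (concatMap (replicate k) xs) ≡ k * count z xs
  count-concatMap-replicate k []       z = sym (*-zeroʳ k)
  count-concatMap-replicate k (x ∷ xs) z = begin
    count z (replicate k x ++ concatMap (replicate k) xs)
      ≡⟨ count-++ z (replicate k x) _ ⟩
    count z (replicate k x) + count z (concatMap (replicate k) xs)
      ≡⟨ cong₂ _+_ (count-replicate k x z) (count-concatMap-replicate k xs z) ⟩
    k * δ x z + k * count z xs
      ≡⟨ *-distribˡ-+ k (δ x z) _ ⟨
    k * (δ x z + count z xs)
      ∎
    where open ≡-Reasoning

  count-tabulate-≢ : ∀ {n} (f : Fin n → A) z → (∀ i → f i ≢ z) → count z (tabulate f) ≡ 0
  count-tabulate-≢ {zero}  f z f≢z = refl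
  count-tabulate-≢ {suc n} f z f≢z =
    cong₂ _+_ (δ-≢ (f≢z fzero)) (count-tabulate-≢ (f ∘ fsuc) z (f≢z ∘ fsuc))

  count-tabulate-injective : ∀ {n} (f : Fin n → A) → (∀ {i j} → f i ≡ f j → i ≡ j) →
                             ∀ i → count (f i) (tabulate f) ≡ 1
  count-tabulate-injective f inj fzero    = cong₂ _+_ (δ-refl (f fzero))
    (count-tabulate-≢ (f ∘ fsuc) (f fzero) λ i e → contradiction (inj e) λ ())
  count-tabulate-injective f inj (fsuc i) = cong₂ _+_ (δ-≢ λ e → contradiction (inj e) λ ())
    (count-tabulate-injective (f ∘ fsuc) (fsuc-injective ∘ inj) i)

  count-↭ : ∀ {xs ys} → xs ↭ ys → ∀ z → count z xs ≡ count z ys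
  count-↭ ↭-refl        z = refl
  count-↭ (prep x p)    z = cong (δ x z +_) (count-↭ p z)
  count-↭ (swap x y p)  z = begin
    δ x z + (δ y z + _) ≡⟨ +-assoc (δ x z) _ _ ⟨
    δ x z + δ y z + _   ≡⟨ cong₂ _+_ (+-comm (δ x z) (δ y z)) (count-↭ p z) ⟩
    δ y z + δ x z + _   ≡⟨ +-assoc (δ y z) _ _ ⟩
    δ y z + (δ x z + _) ∎
    where open ≡-Reasoning
  count-↭ (↭-trans p q) z = trans (count-↭ p z) (count-↭ q z)

  Occurs-here : ∀ a v → Occurs a (a ∷ v)
  Occurs-here a v rewrite δ-refl a = s≤s z≤n

  Occurs-there : ∀ {z} x v → Occurs z v → Occurs z (x ∷ v)
  Occurs-there {z} x _ p = ≤-trans p (m≤n+m _ (δ x z))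

  Occurs-∷⁻ : ∀ a z v → Occurs z (a ∷ v) → a ≡ z ⊎ Occurs z v
  Occurs-∷⁻ a z v p with a ≟ z
  ... | yes a≡z = inj₁ a≡z
  ... | no  _   = inj₂ p

  Occurs⇒split : ∀ x ys → Occurs x ys → ∃₂ λ ys₁ ys₂ → ys ≡ ys₁ ++ x ∷ ys₂ × ¬ Occurs x ys₁
  Occurs⇒split x (y ∷ ys) p with y ≟ x
  ... | yes refl = [] , ys , refl , λ ()
  ... | no  y≢x with Occurs⇒split x ys p
  ...   | ys₁ , ys₂ , refl , x∉ys₁ =
    y ∷ ys₁ , ys₂ , refl , x∉ys₁ ∘ subst (0 <_) (count-∷-≢ ys₁ y≢x)

  count⇒↭ : ∀ xs ys → (∀ z → count z xs ≡ count z ys) → xs ↭ ys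
  count⇒↭ []       []       _ = ↭-refl
  count⇒↭ []       (y ∷ ys) c = contradiction (subst (0 <_) (sym (c y)) (Occurs-here y ys)) λ ()
  count⇒↭ (x ∷ xs) ys c with Occurs⇒split x ys (subst (0 <_) (c x) (Occurs-here x xs))
  ... | ys₁ , ys₂ , refl , _ =
    ↭-trans (prep x (count⇒↭ xs (ys₁ ++ ys₂) counts)) (↭-sym (shift x ys₁ ys₂))
    where
    counts : ∀ z → count z xs ≡ count z (ys₁ ++ ys₂)
    counts z = +-cancelˡ-≡ (δ x z) _ _ (trans (c z) (count-↭ (shift x ys₁ ys₂) z))

  Occurs⇒⊆ : ∀ z u → Occurs z u → z ∷ [] ⊆ u
  Occurs⇒⊆ z (x ∷ u) p with x ≟ z
  ... | yes refl = refl ∷ minimum u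
  ... | no  _    = x ∷ʳ Occurs⇒⊆ z u p

  ⊆⇒Occurs : ∀ z {u} → z ∷ [] ⊆ u → Occurs z u
  ⊆⇒Occurs z {y ∷ u} (y ∷ʳ s)   = Occurs-there y u (⊆⇒Occurs z s)
  ⊆⇒Occurs z {_ ∷ u} (refl ∷ _) = Occurs-here z u

  count-mono-⊆ : ∀ z {xs ys} → xs ⊆ ys → count z xs ≤ count z ys
  count-mono-⊆ z []                   = z≤n
  count-mono-⊆ z (y ∷ʳ s)             = ≤-trans (count-mono-⊆ z s) (m≤n+m _ (δ y z))
  count-mono-⊆ z (_∷_ {x = x} refl s) = +-monoʳ-≤ (δ x z) (count-mono-⊆ z s)

  Distinct-⊆ : ∀ {xs ys} → xs ⊆ ys → Distinct ys → Distinct xs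
  Distinct-⊆ s d z zz = d z (⊆-trans zz s)

  Distinct-++⇒Disjoint : ∀ xs ys → Distinct (xs ++ ys) → Disjoint xs ys
  Distinct-++⇒Disjoint xs ys d z p q = d z (++⁺ (Occurs⇒⊆ z xs p) (Occurs⇒⊆ z ys q))

  Distinct-∷⇒¬Occurs : ∀ a xs → Distinct (a ∷ xs) → ¬ Occurs a xs
  Distinct-∷⇒¬Occurs a xs d p = d a (refl ∷ Occurs⇒⊆ a xs p)

  count≤1⇒Distinct : ∀ xs → (∀ z → count z xs ≤ 1) → Distinct xs
  count≤1⇒Distinct xs c z zz with count-mono-⊆ z zz
  ... | twice≤ rewrite δ-refl z = contradiction (≤-trans twice≤ (c z)) λ { (s≤s ()) }

  ⊆-++-split : ∀ us {vs xs} → xs ⊆ us ++ vs → ∃₂ λ p q → xs ≡ p ++ q × p ⊆ us × q ⊆ vs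
  ⊆-++-split []       s          = [] , _ , refl , [] , s
  ⊆-++-split (u ∷ us) (u ∷ʳ s)   with ⊆-++-split us s
  ... | p , q , refl , pu , qv = p , q , refl , u ∷ʳ pu , qv
  ⊆-++-split (u ∷ us) (refl ∷ s) with ⊆-++-split us s
  ... | p , q , refl , pu , qv = u ∷ p , q , refl , refl ∷ pu , qv

  ++-cancel-at : ∀ a {xs xs′ ys ys′} → ¬ Occurs a xs → ¬ Occurs a xs′ →
                 xs ++ a ∷ ys ≡ xs′ ++ a ∷ ys′ → xs ≡ xs′ × ys ≡ ys′
  ++-cancel-at a {[]}     {[]}       _  _   refl = refl , refl
  ++-cancel-at a {[]}     {x′ ∷ xs′} _  a∉′ refl = contradiction (Occurs-here a xs′) a∉′
  ++-cancel-at a {x ∷ xs} {[]}       a∉ _   refl = contradiction (Occurs-here a xs) a∉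
  ++-cancel-at a {x ∷ xs} {x′ ∷ xs′} a∉ a∉′ eq with ∷-injective eq
  ... | refl , eq′ with ++-cancel-at a (a∉ ∘ Occurs-there x xs) (a∉′ ∘ Occurs-there x xs′) eq′
  ...   | refl , refl = refl , refl

  -- Pattern avoidance

  Avoids : List A → Set
  Avoids w = ∀ a b → a ≢ b → ¬ (a ∷ b ∷ a ∷ b ∷ [] ⊆ w)

  Avoids-⊆ : ∀ {u w} → u ⊆ w → Avoids w → Avoids u
  Avoids-⊆ u⊆w av a b a≢b s = av a b a≢b (⊆-trans s u⊆w)

  Avoids-[] : Avoids []
  Avoids-[] a b a≢b ()

  Avoids-[_] : ∀ a → Avoids (a ∷ [])
  Avoids-[ a ] x y x≢y (_ ∷ʳ ())
  Avoids-[ a ] x y x≢y (refl ∷ ())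

  Avoids-++ : ∀ {u v} → Avoids u → Avoids v → Disjoint u v → Avoids (u ++ v)
  Avoids-++ {u} au av dj a b a≢b s with ⊆-++-split u s
  ... | []                 , _ , refl , _  , qv = av a b a≢b qv
  ... | _ ∷ []             , _ , refl , pu , qv =
    dj a (⊆⇒Occurs a pu) (⊆⇒Occurs a (⊆-trans (b ∷ʳ refl ∷ minimum _) qv))
  ... | _ ∷ _ ∷ []         , _ , refl , pu , qv =
    dj b (⊆⇒Occurs b (⊆-trans (a ∷ʳ refl ∷ []) pu)) (⊆⇒Occurs b (⊆-trans (a ∷ʳ refl ∷ []) qv))
  ... | _ ∷ _ ∷ _ ∷ []     , _ , refl , pu , qv =
    dj b (⊆⇒Occurs b (⊆-trans (a ∷ʳ refl ∷ minimum _) pu)) (⊆⇒Occurs b qv)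
  ... | _ ∷ _ ∷ _ ∷ _ ∷ [] , _ , refl , pu , _  = au a b a≢b pu

  Avoids-wrap : ∀ {a g v} → Avoids g → Avoids (a ∷ v) → ¬ Occurs a g → Disjoint g v →
                Avoids (a ∷ g ++ a ∷ v)
  Avoids-wrap {a} {g} {v} ag av a∉g dj x y x≢y (_ ∷ʳ s) = Avoids-++ ag av dj′ x y x≢y s
    where
    dj′ : Disjoint g (a ∷ v)
    dj′ z p q with Occurs-∷⁻ a z v q
    ... | inj₁ refl = a∉g p
    ... | inj₂ q′   = dj z p q′
  Avoids-wrap {a} {g} {v} ag av a∉g dj x y x≢y (refl ∷ s) with ⊆-++-split g s
  ... | []     , _ , refl , _  , _ ∷ʳ r   = av a y x≢y (refl ∷ r)
  ... | []     , _ , refl , _  , refl ∷ _ = x≢y refl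
  ... | _ ∷ [] , _ , refl , pu , qv
    with Occurs-∷⁻ a y v (⊆⇒Occurs y (⊆-trans (a ∷ʳ refl ∷ []) qv))
  ...   | inj₁ a≡y = x≢y a≡y
  ...   | inj₂ q   = dj y (⊆⇒Occurs y pu) q
  Avoids-wrap ag av a∉g dj x y x≢y (refl ∷ s) | _ ∷ _ ∷ [] , _ , refl , pu , _ =
    a∉g (⊆⇒Occurs x (⊆-trans (y ∷ʳ refl ∷ []) pu))
  Avoids-wrap ag av a∉g dj x y x≢y (refl ∷ s) | _ ∷ _ ∷ _ ∷ [] , _ , refl , pu , _ =
    a∉g (⊆⇒Occurs x (⊆-trans (y ∷ʳ refl ∷ minimum _) pu))

  Avoids-wrap⁻ : ∀ a g v → Avoids (a ∷ g ++ a ∷ v) → ¬ Occurs a g → Disjoint g v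
  Avoids-wrap⁻ a g v av a∉g z p q =
    av a z (λ { refl → a∉g p }) (refl ∷ ++⁺ (Occurs⇒⊆ z g p) (refl ∷ Occurs⇒⊆ z v q))

  SublistFrom : ℕ → List A → List A → Set
  SublistFrom lo []       w = ⊤
  SublistFrom lo (x ∷ xs) w =
    ∃ λ (i : Fin (length w)) → lo ≤ toℕ i × lookup w i ≡ x × SublistFrom (suc (toℕ i)) xs w

  SublistFrom-∷⁺ : ∀ xs {y w lo} → SublistFrom lo xs w → SublistFrom (suc lo) xs (y ∷ w)
  SublistFrom-∷⁺ []       _                   = tt
  SublistFrom-∷⁺ (x ∷ xs) (i , lo≤i , eq , e) = fsuc i , s≤s lo≤i , eq , SublistFrom-∷⁺ xs e

  SublistFrom-∷⁻ : ∀ xs {y w lo} → SublistFrom (suc lo) xs (y ∷ w) → SublistFrom lo xs w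
  SublistFrom-∷⁻ []       _                            = tt
  SublistFrom-∷⁻ (x ∷ xs) (fsuc i , s≤s lo≤i , eq , e) = i , lo≤i , eq , SublistFrom-∷⁻ xs e

  SublistFrom-weaken : ∀ xs {w lo} → SublistFrom (suc lo) xs w → SublistFrom lo xs w
  SublistFrom-weaken []       _                   = tt
  SublistFrom-weaken (x ∷ xs) (i , lo<i , eq , e) = i , ≤-trans (n≤1+n _) lo<i , eq , e

  ⊆⇒SublistFrom : ∀ {xs w} → xs ⊆ w → SublistFrom 0 xs w
  ⊆⇒SublistFrom []                  = tt
  ⊆⇒SublistFrom {xs}     (y ∷ʳ s)   = SublistFrom-weaken xs (SublistFrom-∷⁺ xs (⊆⇒SublistFrom s))
  ⊆⇒SublistFrom {_ ∷ xs} (refl ∷ s) = fzero , z≤n , refl , SublistFrom-∷⁺ xs (⊆⇒SublistFrom s)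

  SublistFrom⇒⊆ : ∀ w xs → SublistFrom 0 xs w → xs ⊆ w
  SublistFrom⇒⊆ w       []       _                       = minimum w
  SublistFrom⇒⊆ (y ∷ w) (x ∷ xs) (fzero  , _ , refl , e) = refl ∷ SublistFrom⇒⊆ w xs (SublistFrom-∷⁻ xs e)
  SublistFrom⇒⊆ (y ∷ w) (x ∷ xs) (fsuc i , _ , eq , e)   =
    y ∷ʳ SublistFrom⇒⊆ w (x ∷ xs) (i , z≤n , eq , SublistFrom-∷⁻ xs e)

  Avoids⇒¬Contains : ∀ w → Avoids w → ¬ Contains1212or2121 w
  Avoids⇒¬Contains w av (i , j , l , m , i<j , j<l , l<m , wᵢ≡wₗ , wⱼ≡wₘ , wᵢ≢wⱼ) =
    av (lookup w i) (lookup w j) wᵢ≢wⱼ (SublistFrom⇒⊆ w _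
      (i , z≤n , refl , j , i<j , refl , l , j<l , sym wᵢ≡wₗ , m , l<m , sym wⱼ≡wₘ , tt))

  ¬Contains⇒Avoids : ∀ w → ¬ Contains1212or2121 w → Avoids w
  ¬Contains⇒Avoids w ¬c a b a≢b s with ⊆⇒SublistFrom s
  ... | i , _ , wᵢ≡a , j , i<j , wⱼ≡b , l , j<l , wₗ≡a , m , l<m , wₘ≡b , tt =
    ¬c (i , j , l , m , i<j , j<l , l<m , trans wᵢ≡a (sym wₗ≡a) , trans wⱼ≡b (sym wₘ≡b) ,
        λ wᵢ≡wⱼ → a≢b (trans (sym wᵢ≡a) (trans wᵢ≡wⱼ wⱼ≡b)))

private
  *-posʳ⁻ : ∀ x y → 0 < x * y → 0 < y
  *-posʳ⁻ x zero    p = contradiction (subst (0 <_) (*-zeroʳ x) p) λ ()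
  *-posʳ⁻ x (suc y) _ = s≤s z≤n

  +-pos⁻ : ∀ x y → 0 < x + y → 0 < x ⊎ 0 < y
  +-pos⁻ zero    y p = inj₂ p
  +-pos⁻ (suc x) y _ = inj₁ (s≤s z≤n)

module Encoding {m n : ℕ} where

  open Words (_≟_ {n})
  open import Data.List.Relation.Binary.Sublist.Propositional {A = Fin n}
    using (_⊆_; _∷_; _∷ʳ_; ⊆-refl)

  mutual
    encodeSub : Sub m n → List (Fin n)
    encodeSub (node a cs) = a ∷ encodeComps a cs

    encodeComps : ∀ {j} → Fin n → Vec (PlaneTree m n) j → List (Fin n)
    encodeComps a []       = []
    encodeComps a (c ∷ cs) = encode c ++ a ∷ encodeComps a cs

    encode : PlaneTree m n → List (Fin n)
    encode []       = []
    encode (t ∷ ts) = encodeSub t ++ encode ts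

  mutual
    count-encodeSub : ∀ t z → count z (encodeSub t) ≡ suc m * count z (labelsSub t)
    count-encodeSub (node a cs) z = begin
      δ a z + count z (encodeComps a cs)                      ≡⟨ cong (δ a z +_) (count-encodeComps a cs z) ⟩
      δ a z + (m * δ a z + suc m * count z (labelsComps cs))  ≡⟨ regroup (δ a z) m _ ⟩
      suc m * (δ a z + count z (labelsComps cs))              ∎
      where
      open ≡-Reasoning
      regroup : ∀ d m c → d + (m * d + suc m * c) ≡ suc m * (d + c)
      regroup = solve-∀

    count-encodeComps : ∀ {j} a (cs : Vec (PlaneTree m n) j) z →
                        count z (encodeComps a cs) ≡ j * δ a z + suc m * count z (labelsComps cs)
    count-encodeComps         a []       z = sym (*-zeroʳ (suc m))
    count-encodeComps {suc j} a (c ∷ cs) z = begin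
      count z (encode c ++ a ∷ encodeComps a cs)
        ≡⟨ count-++ z (encode c) _ ⟩
      count z (encode c) + (δ a z + count z (encodeComps a cs))
        ≡⟨ cong₂ (λ x y → x + (δ a z + y)) (count-encode c z) (count-encodeComps a cs z) ⟩
      suc m * count z (labelsList c) + (δ a z + (j * δ a z + suc m * count z (labelsComps cs)))
        ≡⟨ regroup m (count z (labelsList c)) (δ a z) j _ ⟩
      suc j * δ a z + suc m * (count z (labelsList c) + count z (labelsComps cs))
        ≡⟨ cong (λ x → suc j * δ a z + suc m * x) (count-++ z (labelsList c) _) ⟨
      suc j * δ a z + suc m * count z (labelsList c ++ labelsComps cs)
        ∎
      where
      open ≡-Reasoning
      regroup : ∀ m x d j y → suc m * x + (d + (j * d + suc m * y)) ≡ suc j * d + suc m * (x + y)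
      regroup = solve-∀

    count-encode : ∀ ts z → count z (encode ts) ≡ suc m * count z (labelsList ts)
    count-encode []       z = sym (*-zeroʳ (suc m))
    count-encode (t ∷ ts) z = begin
      count z (encodeSub t ++ encode ts)
        ≡⟨ count-++ z (encodeSub t) _ ⟩
      count z (encodeSub t) + count z (encode ts)
        ≡⟨ cong₂ _+_ (count-encodeSub t z) (count-encode ts z) ⟩
      suc m * count z (labelsSub t) + suc m * count z (labelsList ts)
        ≡⟨ *-distribˡ-+ (suc m) (count z (labelsSub t)) _ ⟨
      suc m * (count z (labelsSub t) + count z (labelsList ts))
        ≡⟨ cong (suc m *_) (count-++ z (labelsSub t) _) ⟨
      suc m * count z (labelsSub t ++ labelsList ts)
        ∎
      where open ≡-Reasoning

  Occurs-encode⁻ : ∀ ts z → Occurs z (encode ts) → Occurs z (labelsList ts)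
  Occurs-encode⁻ ts z p = *-posʳ⁻ (suc m) _ (subst (0 <_) (count-encode ts z) p)

  Occurs-encodeSub⁻ : ∀ t z → Occurs z (encodeSub t) → Occurs z (labelsSub t)
  Occurs-encodeSub⁻ t z p = *-posʳ⁻ (suc m) _ (subst (0 <_) (count-encodeSub t z) p)

  Occurs-encodeComps⁻ : ∀ {j} a (cs : Vec (PlaneTree m n) j) z →
                        Occurs z (encodeComps a cs) → a ≡ z ⊎ Occurs z (labelsComps cs)
  Occurs-encodeComps⁻ {j} a cs z p
    with +-pos⁻ (j * δ a z) _ (subst (0 <_) (count-encodeComps a cs z) p)
  ... | inj₁ q = inj₁ (δ-pos⇒≡ (*-posʳ⁻ j _ q))
  ... | inj₂ q = inj₂ (*-posʳ⁻ (suc m) _ q)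

  Distinct-compartment : ∀ {j} a c (cs : Vec (PlaneTree m n) j) →
                         Distinct (a ∷ labelsList c ++ labelsComps cs) →
                         Distinct (labelsList c) × Distinct (a ∷ labelsComps cs) × ¬ Occurs a (encode c)
  Distinct-compartment a c cs d =
    Distinct-⊆ (a ∷ʳ ++⁺ʳ _ ⊆-refl) d ,
    Distinct-⊆ (refl ∷ ++⁺ˡ (labelsList c) ⊆-refl) d ,
    Distinct-∷⇒¬Occurs a (labelsList c) (Distinct-⊆ (refl ∷ ++⁺ʳ _ ⊆-refl) d) ∘ Occurs-encode⁻ c a

  mutual
    encode-avoids : ∀ ts → Distinct (labelsList ts) → Avoids (encode ts)
    encode-avoids []       _ = Avoids-[]
    encode-avoids (t ∷ ts) d =
      Avoids-++ (encodeSub-avoids t (Distinct-⊆ (++⁺ʳ _ ⊆-refl) d))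
                (encode-avoids ts (Distinct-⊆ (++⁺ˡ (labelsSub t) ⊆-refl) d))
                (λ z p q → Distinct-++⇒Disjoint (labelsSub t) _ d z
                             (Occurs-encodeSub⁻ t z p) (Occurs-encode⁻ ts z q))

    encodeSub-avoids : ∀ t → Distinct (labelsSub t) → Avoids (encodeSub t)
    encodeSub-avoids (node a cs) = encodeComps-avoids a cs

    encodeComps-avoids : ∀ {j} a (cs : Vec (PlaneTree m n) j) →
                         Distinct (a ∷ labelsComps cs) → Avoids (a ∷ encodeComps a cs)
    encodeComps-avoids a []       _ = Avoids-[ a ]
    encodeComps-avoids a (c ∷ cs) d with Distinct-compartment a c cs d
    ... | dc , dcs , a∉c = Avoids-wrap (encode-avoids c dc) (encodeComps-avoids a cs dcs) a∉c disjoint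
      where
      disjoint : Disjoint (encode c) (encodeComps a cs)
      disjoint z p q with Occurs-encodeComps⁻ a cs z q
      ... | inj₁ refl = a∉c p
      ... | inj₂ q′   = Distinct-++⇒Disjoint (labelsList c) _ (Distinct-⊆ (a ∷ʳ ⊆-refl) d) z
                          (Occurs-encode⁻ c z p) q′

  mutual
    encode-injective : ∀ ts ts′ → Distinct (labelsList ts) → Distinct (labelsList ts′) →
                       encode ts ≡ encode ts′ → ts ≡ ts′
    encode-injective []              []                 _ _  _  = refl
    encode-injective []              (node _ _ ∷ _)     _ _  ()
    encode-injective (node _ _ ∷ _)  []                 _ _  ()
    encode-injective (node a cs ∷ r) (node a′ cs′ ∷ r′) d d′ eq with ∷-injective eq
    ... | refl , eq′ with encodeComps-injective a cs cs′ (encode r) (encode r′)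
                            (Distinct-⊆ (++⁺ʳ _ ⊆-refl) d) (Distinct-⊆ (++⁺ʳ _ ⊆-refl) d′) eq′
    ...   | refl , eq″ with encode-injective r r′
                              (Distinct-⊆ (++⁺ˡ (a ∷ labelsComps cs) ⊆-refl) d)
                              (Distinct-⊆ (++⁺ˡ (a ∷ labelsComps cs) ⊆-refl) d′) eq″
    ...     | refl = refl

    encodeComps-injective : ∀ {j} a (cs cs′ : Vec (PlaneTree m n) j) r r′ →
                            Distinct (a ∷ labelsComps cs) → Distinct (a ∷ labelsComps cs′) →
                            encodeComps a cs ++ r ≡ encodeComps a cs′ ++ r′ → cs ≡ cs′ × r ≡ r′
    encodeComps-injective a []       []         r r′ _ _  eq = refl , eq
    encodeComps-injective a (c ∷ cs) (c′ ∷ cs′) r r′ d d′ eq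
      with Distinct-compartment a c cs d | Distinct-compartment a c′ cs′ d′
    ... | dc , dcs , a∉c | dc′ , dcs′ , a∉c′
      with ++-cancel-at a a∉c a∉c′
             (trans (sym (++-assoc (encode c) _ r)) (trans eq (++-assoc (encode c′) _ r′)))
    ... | eqc , eqcs
      with encode-injective c c′ dc dc′ eqc | encodeComps-injective a cs cs′ r r′ dcs dcs′ eqcs
    ...   | refl | refl , eqr = refl , eqr

  -- Decoding

  Uniform : List (Fin n) → Set
  Uniform w = ∀ z → Occurs z w → count z w ≡ suc m

  UniformExcept : Fin n → List (Fin n) → Set
  UniformExcept a u = ∀ z → z ≢ a → Occurs z u → count z u ≡ suc m

  private
    uniform-transfer : ∀ {z} w w′ → count z w ≡ count z w′ →
                       (Occurs z w′ → count z w′ ≡ suc m) → Occurs z w → count z w ≡ suc m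
    uniform-transfer w w′ e h p = trans e (h (subst (0 <_) e p))

  mutual
    decode : ∀ f w → length w ≤ f → Avoids w → Uniform w → ∃ λ ts → encode ts ≡ w
    decode f       []      _        _  _   = [] , refl
    decode (suc f) (a ∷ u) (s≤s le) av uni with decodeComps f m a u le count-a av uni′
      where
      count-a : count a u ≡ m
      count-a = suc-injective (trans (sym (count-∷-≡ a u)) (uni a (Occurs-here a u)))
      uni′ : UniformExcept a u
      uni′ z z≢a = uniform-transfer u (a ∷ u) (sym (count-∷-≢ u (z≢a ∘ sym))) (uni z)
    ... | cs , r , eq = node a cs ∷ r , cong (a ∷_) eq

    decodeComps : ∀ f j a u → length u ≤ f → count a u ≡ j → Avoids (a ∷ u) → UniformExcept a u →
                  ∃₂ λ (cs : Vec (PlaneTree m n) j) r → encodeComps a cs ++ encode r ≡ u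
    decodeComps f zero a u le a∉u av uni with decode f u le (Avoids-⊆ (a ∷ʳ ⊆-refl) av) uni′
      where
      uni′ : Uniform u
      uni′ z p = uni z (λ { refl → <⇒≢ p (sym a∉u) }) p
    ... | r , eq = [] , r , eq
    decodeComps f (suc j) a u le count-a av uni
      with Occurs⇒split a u (subst (0 <_) (sym count-a) (s≤s z≤n))
    ... | g , u′ , refl , a∉g
      with decode f g (≤-trans (length-mono-≤ g⊆u) le) (Avoids-⊆ (a ∷ʳ g⊆u) av) uni-g
         | decodeComps f j a u′ (≤-trans (length-mono-≤ u′⊆u) le) count-a′
             (Avoids-⊆ (refl ∷ u′⊆u) av) uni-u′
      where
      g⊆u : g ⊆ g ++ a ∷ u′
      g⊆u = ++⁺ʳ (a ∷ u′) ⊆-refl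
      u′⊆u : u′ ⊆ g ++ a ∷ u′
      u′⊆u = ++⁺ˡ g (a ∷ʳ ⊆-refl)
      disjoint : Disjoint g u′
      disjoint = Avoids-wrap⁻ a g u′ av a∉g
      count-a′ : count a u′ ≡ j
      count-a′ = suc-injective
        (trans (sym (trans (count-++-¬Occursˡ a g (a ∷ u′) a∉g) (count-∷-≡ a u′))) count-a)
      uni-g : Uniform g
      uni-g z p = uniform-transfer g (g ++ a ∷ u′)
                    (sym (count-++-¬Occursʳ z g (a ∷ u′) z∉au′)) (uni z z≢a) p
        where
        z≢a : z ≢ a
        z≢a refl = a∉g p
        z∉au′ : ¬ Occurs z (a ∷ u′)
        z∉au′ q with Occurs-∷⁻ a z u′ q
        ... | inj₁ a≡z = z≢a (sym a≡z)
        ... | inj₂ q′  = disjoint z p q′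
      uni-u′ : UniformExcept a u′
      uni-u′ z z≢a q = uniform-transfer u′ (g ++ a ∷ u′) (sym count-z) (uni z z≢a) q
        where
        count-z : count z (g ++ a ∷ u′) ≡ count z u′
        count-z = trans (count-++-¬Occursˡ z g (a ∷ u′) (λ p → disjoint z p q))
                        (count-∷-≢ u′ (z≢a ∘ sym))
    ... | c , eqc | cs , r , eqr =
      c ∷ cs , r , trans (++-assoc (encode c) _ (encode r)) (cong₂ (λ x y → x ++ a ∷ y) eqc eqr)

module _ (m n : ℕ) where

  open Words (_≟_ {n})
  open Encoding {m} {n}

  count-allFin : ∀ z → count z (allFin n) ≡ 1
  count-allFin = count-tabulate-injective (λ i → i) (λ i≡j → i≡j)

  count-multiset : ∀ z → count z (multiset (suc m) n) ≡ suc m * count z (allFin n)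
  count-multiset = count-concatMap-replicate (suc m) (allFin n)

  ↭-allFin⇒Distinct : ∀ {xs} → xs ↭ allFin n → Distinct xs
  ↭-allFin⇒Distinct {xs} p =
    count≤1⇒Distinct xs λ z → ≤-reflexive (trans (count-↭ p z) (count-allFin z))

  encode-↭-multiset : ∀ ts → labelsList ts ↭ allFin n → encode ts ↭ multiset (suc m) n
  encode-↭-multiset ts p = count⇒↭ _ _ λ z → begin
    count z (encode ts)              ≡⟨ count-encode ts z ⟩
    suc m * count z (labelsList ts)  ≡⟨ cong (suc m *_) (count-↭ p z) ⟩
    suc m * count z (allFin n)       ≡⟨ count-multiset z ⟨
    count z (multiset (suc m) n)     ∎
    where open ≡-Reasoning

  encode-↭-multiset⁻ : ∀ ts → encode ts ↭ multiset (suc m) n → labelsList ts ↭ allFin n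
  encode-↭-multiset⁻ ts p = count⇒↭ _ _ λ z → *-cancelˡ-≡ _ _ (suc m) (begin
    suc m * count z (labelsList ts)  ≡⟨ count-encode ts z ⟨
    count z (encode ts)              ≡⟨ count-↭ p z ⟩
    count z (multiset (suc m) n)     ≡⟨ count-multiset z ⟩
    suc m * count z (allFin n)       ∎)
    where open ≡-Reasoning

  encode-bijection : Bijection (T-setoid (suc m) n) (Q̄-setoid (suc m) n)
  encode-bijection = record
    { to        = λ (ts , p) → encode ts , encode-↭-multiset ts p ,
                               Avoids⇒¬Contains _ (encode-avoids ts (↭-allFin⇒Distinct p))
    ; cong      = cong encode
    ; bijective = (λ {(ts , p)} {(ts′ , p′)} →
                     encode-injective ts ts′ (↭-allFin⇒Distinct p) (↭-allFin⇒Distinct p′))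
                , surjective
    }
    where
    uniform : ∀ {w} → w ↭ multiset (suc m) n → Uniform w
    uniform {w} p z _ = begin
      count z w                     ≡⟨ count-↭ p z ⟩
      count z (multiset (suc m) n)  ≡⟨ count-multiset z ⟩
      suc m * count z (allFin n)    ≡⟨ cong (suc m *_) (count-allFin z) ⟩
      suc m * 1                     ≡⟨ *-identityʳ (suc m) ⟩
      suc m                         ∎
      where open ≡-Reasoning

    surjective : ∀ ((w , _) : Q̄ (suc m) n) →
                 ∃ λ ((ts , _) : T (suc m) n) → ∀ {x} → proj₁ x ≡ ts → encode (proj₁ x) ≡ w
    surjective (w , p , ¬c) with decode (length w) w ≤-refl (¬Contains⇒Avoids w ¬c) (uniform p)
    ... | ts , refl = (ts , encode-↭-multiset⁻ ts p) , cong encode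

-- The bijection exists for every k = suc m ≥ 1; the hypothesis 2 ≤ k only rules out k = 0.
theorem4p2 : (k n : ℕ) → 2 ≤ k → Bijection (T-setoid k n) (Q̄-setoid k n)
theorem4p2 zero    n ()
theorem4p2 (suc m) n _  = encode-bijection m n
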